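{- Assume that for every universe \(\mathcal T\), the type \(\Omega_{\mathcal T}\) has size \(\mathcal U_0\). Let \(X\) be a poset with carrier in a universe \(\mathcal U\). Then the following are equivalent: (i) \(X\) has suprema for all subsets \(S:X\to\Omega_{\mathcal T}\) (for every universe \(\mathcal T\)); (ii) \(X\) has suprema for all \(\mathcal U\)-covered subsets; (iii) \(X\) has suprema for all subsets whose total spaces have size \(\mathcal U\); (iv) \(X\) has suprema for all families \(I\to X\) with \(I:\mathcal U\).
   Context: Setting: intensional Martin-Löf type theory with universes (\(\mathcal U_0\) the lowest universe), function extensionality, propositional extensionality, propositional truncation. \(\Omega_{\mathcal T}\) is the type of propositions in \(\mathcal T\); a type has size \(\mathcal W\) if it is equivalent to a type in \(\mathcal W\). A poset is a type with a proposition-valued reflexive, transitive, antisymmetric relation. A subset of \(X\) is a map \(S:X\to\Omega_{\mathcal T}\) for some universe \(\mathcal T\); a supremum of \(S\) is a least upper bound of \(\{x : S(x)\}\). The total space of \(S\) is \(\mathbb T(S):=\Sigma_{x:X}S(x)\). \(S\) is \(\mathcal U\)-covered if there is a type \(I:\mathcal U\) with a surjection \(I\twoheadrightarrow\mathbb T(S)\). -}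

module Defs where

open import Level using (Level; _⊔_; 0ℓ; Setω) renaming (suc to lsuc)
open import Data.Product using (Σ; Σ-syntax; _×_; _,_; proj₁)
open import Relation.Binary.PropositionalEquality using (_≡_)
open import Function.Bundles using (_↔_)

-- Ambient axioms of the paper's type theory, taken as explicit hypotheses.

isProp : ∀ {a} → Set a → Set a
isProp A = (x y : A) → x ≡ y

FunExt : Setω
FunExt = ∀ {a b} {A : Set a} {B : A → Set b} {f g : (x : A) → B x}
         → ((x : A) → f x ≡ g x) → f ≡ g

PropExt : Setω
PropExt = ∀ {a} {P Q : Set a} → isProp P → isProp Q → (P → Q) → (Q → P) → P ≡ Q

record PropTrunc : Setω where
  field
    ∥_∥    : ∀ {a} → Set a → Set a
    ∣_∣    : ∀ {a} {A : Set a} → A → ∥ A ∥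
    squash : ∀ {a} {A : Set a} → isProp ∥ A ∥
    rec    : ∀ {a b} {A : Set a} {B : Set b} → isProp B → (A → B) → ∥ A ∥ → B

HasSize : ∀ {a} (w : Level) → Set a → Set (a ⊔ lsuc w)
HasSize w A = Σ[ B ∈ Set w ] (B ↔ A)

Ω : (t : Level) → Set (lsuc t)
Ω t = Σ[ P ∈ Set t ] isProp P

record Poset (u v : Level) : Set (lsuc (u ⊔ v)) where
  field
    Carrier  : Set u
    _≤_      : Carrier → Carrier → Set v
    ≤-prop   : ∀ x y → isProp (x ≤ y)
    ≤-refl   : ∀ x → x ≤ x
    ≤-trans  : ∀ {x y z} → x ≤ y → y ≤ z → x ≤ z
    ≤-antisym : ∀ {x y} → x ≤ y → y ≤ x → x ≡ y

module _ {u v : Level} (X : Poset u v) where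
  open Poset X

  𝕋 : ∀ {t} → (Carrier → Ω t) → Set (u ⊔ t)
  𝕋 S = Σ[ x ∈ Carrier ] proj₁ (S x)

  IsSupOf : ∀ {t} → (Carrier → Ω t) → Carrier → Set (u ⊔ v ⊔ t)
  IsSupOf S s = ((x : Carrier) → proj₁ (S x) → x ≤ s)
              × ((y : Carrier) → ((x : Carrier) → proj₁ (S x) → x ≤ y) → s ≤ y)

  HasSup : ∀ {t} → (Carrier → Ω t) → Set (u ⊔ v ⊔ t)
  HasSup S = Σ[ s ∈ Carrier ] IsSupOf S s

  HasFamSup : ∀ {i} {I : Set i} → (I → Carrier) → Set (u ⊔ v ⊔ i)
  HasFamSup {I = I} α = Σ[ s ∈ Carrier ]
      (((k : I) → α k ≤ s) × ((y : Carrier) → ((k : I) → α k ≤ y) → s ≤ y))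

  Covered : PropTrunc → (w : Level) → ∀ {t} → (Carrier → Ω t) → Set (u ⊔ t ⊔ lsuc w)
  Covered pt w S = Σ[ I ∈ Set w ] Σ[ f ∈ (I → 𝕋 S) ]
      ((y : 𝕋 S) → ∥ Σ[ k ∈ I ] f k ≡ y ∥)
    where open PropTrunc pt

record _×ω_ (A B : Setω) : Setω where
  constructor _,ω_
  field
    fstω : A
    sndω : B

record _⇔ω_ (A B : Setω) : Setω where
  constructor mk⇔ω
  field
    to   : A → B
    from : B → A

module _ (pt : PropTrunc) {u v : Level} (X : Poset u v) where
  open Poset X

  AllSups : Setω
  AllSups = ∀ {t} (S : Carrier → Ω t) → HasSup X S

  CoveredSups : Setω
  CoveredSups = ∀ {t} (S : Carrier → Ω t) → Covered X pt u S → HasSup X S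

  SmallTotalSups : Setω
  SmallTotalSups = ∀ {t} (S : Carrier → Ω t) → HasSize u (𝕋 X S) → HasSup X S

  FamSups : Set (lsuc u ⊔ v)
  FamSups = (I : Set u) (α : I → Carrier) → HasFamSup X α

-- Regard a small type as a Setω-type (for stating the equivalences uniformly).
record Liftω {a} (A : Set a) : Setω where
  constructor liftω
  field lowerω : A

{-# OPTIONS --safe #-}
-- Every condition is a special case of (i), and the image of a family I → X
-- with I : 𝓤 is a 𝓤-covered subset whose total space lives in 𝓤, so (ii) and
-- (iii) each give (iv).  For (iv) ⇒ (i), resize Ω_𝓣 to a type B : 𝓤₀ via
-- ⌜_⌝ : Ω_𝓣 → B; by propositional extensionality S x holds iff ⌜ S x ⌝ ≡ ⌜ ⊤ ⌝,
-- so S is the image of the first projection out of the small type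
-- Σ x, ⌜ S x ⌝ ≡ ⌜ ⊤ ⌝, whose supremum is the supremum of S.
module Submission where

open import Defs
open import Level using (Level; 0ℓ; _⊔_; Lift; lift)
open import Data.Product using (Σ-syntax; _,_; proj₁; proj₂)
open import Data.Unit using (⊤; tt)
open import Relation.Binary.PropositionalEquality using (_≡_; refl; sym; trans; cong; subst)
open import Function.Bundles using (_↔_; _⇔_; mk⇔; Equivalence; Inverse)
open import Function.Properties.Inverse using (↔-refl)
open import Axiom.UniquenessOfIdentityProofs.WithK using (uip)

HasSize-refl : ∀ {a} {A : Set a} → HasSize a A
HasSize-refl = _ , ↔-refl

⊤Ω : ∀ t → Ω t
⊤Ω t = Lift t ⊤ , λ _ _ → refl

isProp-isProp : FunExt → ∀ {a} {P : Set a} (h g : isProp P) → h ≡ g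
isProp-isProp fe h g = fe λ x → fe λ y → uip (h x y) (g x y)

holds⇒≡⊤Ω : FunExt → PropExt → ∀ {t} (P : Ω t) → proj₁ P → P ≡ ⊤Ω t
holds⇒≡⊤Ω fe pe (P , P-prop) p with pe P-prop (proj₂ (⊤Ω _)) (λ _ → lift tt) (λ _ → p)
... | refl = cong (Lift _ ⊤ ,_) (isProp-isProp fe P-prop _)

holds⇔resized≡⊤ : FunExt → PropExt → ∀ {t w} {B : Set w} (e : B ↔ Ω t) (P : Ω t)
  → proj₁ P ⇔ (Inverse.from e P ≡ Inverse.from e (⊤Ω t))
holds⇔resized≡⊤ fe pe e P =
  mk⇔ (λ p → cong from (holds⇒≡⊤Ω fe pe P p))
      (λ q → subst proj₁ (sym (P≡⊤ q)) (lift tt))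
  where
  open Inverse e using (to; from; strictlyInverseˡ)
  P≡⊤ : from P ≡ from (⊤Ω _) → P ≡ ⊤Ω _
  P≡⊤ q = trans (sym (strictlyInverseˡ P)) (trans (cong to q) (strictlyInverseˡ (⊤Ω _)))

module _ (pt : PropTrunc) {u v : Level} (X : Poset u v) where
  open Poset X
  open PropTrunc pt

  image : ∀ {i} {I : Set i} → (I → Carrier) → Carrier → Ω (u ⊔ i)
  image {I = I} α x = ∥ Σ[ k ∈ I ] α k ≡ x ∥ , squash

  image-covered : ∀ {i} {I : Set i} (α : I → Carrier) → Covered X pt i (image α)
  image-covered {I = I} α = I , (λ k → α k , ∣ k , refl ∣) , covers
    where
    covers : (y : 𝕋 X (image α)) → ∥ Σ[ k ∈ I ] (α k , ∣ k , refl ∣) ≡ y ∥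
    covers (x , p) = rec squash (λ { (k , refl) → ∣ k , cong (α k ,_) (squash _ _) ∣ }) p

  HasSup-image⇒HasFamSup : ∀ {i} {I : Set i} (α : I → Carrier)
    → HasSup X (image α) → HasFamSup X α
  HasSup-image⇒HasFamSup α (s , upper , least) =
    s , (λ k → upper (α k) ∣ k , refl ∣) ,
    λ y α≤y → least y (λ x → rec (≤-prop x y) λ { (k , refl) → α≤y k })

  HasFamSup-proj₁⇒HasSup : ∀ {i t} {P : Carrier → Set i} (S : Carrier → Ω t)
    → (∀ x → proj₁ (S x) ⇔ P x) → HasFamSup X (proj₁ {B = P}) → HasSup X S
  HasFamSup-proj₁⇒HasSup S S⇔P (s , upper , least) =
    s , (λ x p → upper (x , to (S⇔P x) p)) ,
    λ y S≤y → least y (λ { (x , q) → S≤y x (from (S⇔P x) q) })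
    where open Equivalence

  coveredSups⇒famSups : CoveredSups pt X → FamSups pt X
  coveredSups⇒famSups sups I α =
    HasSup-image⇒HasFamSup α (sups (image α) (image-covered α))

  smallTotalSups⇒famSups : SmallTotalSups pt X → FamSups pt X
  smallTotalSups⇒famSups sups I α =
    HasSup-image⇒HasFamSup α (sups (image α) HasSize-refl)

  famSups⇒allSups : FunExt → PropExt → ((t : Level) → HasSize 0ℓ (Ω t))
    → FamSups pt X → AllSups pt X
  famSups⇒allSups fe pe Ω-small sups {t} S =
    HasFamSup-proj₁⇒HasSup S S⇔resized (sups (Σ[ x ∈ Carrier ] resized x) proj₁)
    where
    e : proj₁ (Ω-small t) ↔ Ω t
    e = proj₂ (Ω-small t)
    resized : Carrier → Set 0ℓ
    resized x = Inverse.from e (S x) ≡ Inverse.from e (⊤Ω t)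
    S⇔resized : ∀ x → proj₁ (S x) ⇔ resized x
    S⇔resized x = holds⇔resized≡⊤ fe pe e (S x)

theorem5p8 : FunExt → PropExt → (pt : PropTrunc)
    → ((t : Level) → HasSize 0ℓ (Ω t))
    → {u v : Level} (X : Poset u v)
    → (AllSups pt X ⇔ω CoveredSups pt X)
      ×ω ((AllSups pt X ⇔ω SmallTotalSups pt X)
      ×ω (AllSups pt X ⇔ω Liftω (FamSups pt X)))
theorem5p8 fe pe pt Ω-small X =
  mk⇔ω (λ sups S _ → sups S) (λ sups → fam⇒all (coveredSups⇒famSups pt X sups))
  ,ω (mk⇔ω (λ sups S _ → sups S) (λ sups → fam⇒all (smallTotalSups⇒famSups pt X sups))
  ,ω mk⇔ω (λ sups → liftω (coveredSups⇒famSups pt X (λ S _ → sups S)))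
          (λ sups → fam⇒all (Liftω.lowerω sups)))
  where
  fam⇒all : FamSups pt X → AllSups pt X
  fam⇒all = famSups⇒allSups pt X fe pe Ω-small
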